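{- Let $n\geq 3$ and $r\geq 2$ be integers, let $q$ be a positive integer with $2^{q+8r-1}\geq 10(n+1)(q+8r+1)r$, and set $s=q+8r+1$. Let $G$ be an even carousel of order $s$ on $n$ sets $X_1,\dots,X_n$ and let $(Y,Z)$ be a partition of $V(G)$ with $\mathrm{rk}_G(Y,Z)<r$. Then there exists $t\in\{q,\dots,q+8r-1\}$ such that $X_{1,t}\subseteq Z$ or $X_{1,t}\subseteq Y$.
   Context: All graphs are finite and simple. Let $X=\{u^1,\dots,u^k\}$ and $X'=\{v^1,\dots,v^k\}$ be two disjoint ordered sets of $k$ vertices of a graph $G$. The triple $(G,X,X')$ is called: - a regular matching if for all $j,j'\in\{1,\dots,k\}$: $u^jv^{j'}\in E(G)$ iff $j=j'$; - a regular antimatching if: $u^jv^{j'}\in E(G)$ iff $j\neq j'$; - a regular crossing if: $u^jv^{j'}\in E(G)$ iff $j+j'\geq k+1$; - an expanding matching if: $u^jv^{j'}\in E(G)$ iff $j'=2j$ or $j'=2j+1$; - an expanding antimatching if: $u^jv^{j'}\in E(G)$ iff $j'\neq 2j$ and $j'\neq 2j+1$; - an expanding crossing if: $u^jv^{j'}\in E(G)$ iff $2j+j'\geq 2k+2$. Regular (resp. expanding) triples are those of the three regular (resp. expanding) kinds; crossings are cross triples, matchings and antimatchings are parallel triples. An even carousel of order $s$ on $n\geq 3$ sets is a graph $G$ with $V(G)=X_1\cup\dots\cup X_n$ (disjoint), each $X_i=\{x_i^1,\dots,x_i^k\}$ ordered with $k=2^s-1$, such that $(G,X_1,X_2)$ is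 a regular crossing, $(G,X_i,X_{i+1})$ is a regular triple for $2\le i\le n-1$, $(G,X_n,X_1)$ is an expanding triple, and the number of cross triples among $(G,X_i,X_{i+1})$, $i=1,\dots,n$ (indices mod $n$) is even; all other edges are arbitrary. For disjoint $Y,Z\subseteq V(G)$, $\mathrm{rk}_G(Y,Z)$ is the $\mathrm{GF}(2)$-rank of the 0-1 adjacency matrix with rows $Y$ and columns $Z$. For $j\in\{1,\dots,s\}$, $X_{1,j}=\{x_1^{2^{j-1}},\dots,x_1^{2^j-1}\}$. -}

module Defs where

open import Data.Nat using (ℕ; zero; suc; _+_; _*_; _∸_; _^_; _≤_; _<_; _≡ᵇ_; _≤ᵇ_; _%_)
open import Data.Fin using (Fin; toℕ; fromℕ<)
import Data.Fin as Fin
open import Data.Bool using (Bool; true; false; not; _∧_; _∨_; _xor_; if_then_else_)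
open import Data.Product using (Σ; ∃; _×_; _,_)
open import Relation.Binary.PropositionalEquality using (_≡_)
open import Function using (_∘_)

record SimpleGraph (V : Set) : Set where
  field
    adj    : V → V → Bool
    sym    : ∀ x y → adj x y ≡ adj y x
    irrefl : ∀ x → adj x x ≡ false
open SimpleGraph public

xorSum : ∀ {m} → (Fin m → Bool) → Bool
xorSum {zero}  f = false
xorSum {suc m} f = f Fin.zero xor xorSum (f ∘ Fin.suc)

countTrue : ∀ {m} → (Fin m → Bool) → ℕ
countTrue {zero}  f = 0
countTrue {suc m} f = (if f Fin.zero then 1 else 0) + countTrue (f ∘ Fin.suc)

-- Rows f 0, …, f (r-1) (all in Y) of the Y×Z adjacency matrix are linearly
-- independent over GF(2): every nonempty subset of them has a nonzero sum,
-- i.e. the sum is 1 at some column z ∈ Z.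
IndependentRows : ∀ {V : Set} → (V → V → Bool) → (Y Z : V → Bool) → (r : ℕ) → (Fin r → V) → Set
IndependentRows adjm Y Z r f =
  (∀ i → Y (f i) ≡ true) ×
  (∀ (S : Fin r → Bool) → ∃ (λ i → S i ≡ true) →
     ∃ λ z → Z z ≡ true × xorSum (λ i → S i ∧ adjm (f i) z) ≡ true)

-- rk_G(Y,Z) ≥ r : the GF(2)-rank (maximum number of linearly independent rows)
-- of the matrix with rows Y and columns Z is at least r.
RankAtLeast : ∀ {V : Set} → (V → V → Bool) → (Y Z : V → Bool) → ℕ → Set
RankAtLeast {V} adjm Y Z r = ∃ λ (f : Fin r → V) → IndependentRows adjm Y Z r f

RankLessThan : ∀ {V : Set} → (V → V → Bool) → (Y Z : V → Bool) → ℕ → Set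
RankLessThan adjm Y Z r = RankAtLeast adjm Y Z r → Data.Empty.⊥
  where import Data.Empty

data Kind : Set where
  matching antimatching crossing : Kind

isCross : Kind → Bool
isCross crossing = true
isCross _        = false

-- regular pattern: is u^j v^j' an edge (1-based j, j'), for sets of size k
regularPattern : ℕ → Kind → ℕ → ℕ → Bool
regularPattern k matching     j j' = j ≡ᵇ j'
regularPattern k antimatching j j' = not (j ≡ᵇ j')
regularPattern k crossing     j j' = (k + 1) ≤ᵇ (j + j')

expandingPattern : ℕ → Kind → ℕ → ℕ → Bool
expandingPattern k matching     j j' = (j' ≡ᵇ 2 * j) ∨ (j' ≡ᵇ 2 * j + 1)
expandingPattern k antimatching j j' = not ((j' ≡ᵇ 2 * j) ∨ (j' ≡ᵇ 2 * j + 1))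
expandingPattern k crossing     j j' = (2 * k + 2) ≤ᵇ (2 * j + j')

-- (G, X, X') follows the given pattern, X = {u^1..u^k}, X' = {v^1..v^k}
-- (u (fin index a) is u^(a+1)).
TriplePattern : ∀ {V : Set} {k : ℕ} → (V → V → Bool) → (Fin k → V) → (Fin k → V) →
                (ℕ → ℕ → Bool) → Set
TriplePattern adjm u v pat =
  ∀ a b → adjm (u a) (v b) ≡ pat (suc (toℕ a)) (suc (toℕ b))

-- Vertex set X_1 ∪ … ∪ X_n with |X_i| = k: vertex (i , a) is x_{i+1}^{a+1}.
CVertex : ℕ → ℕ → Set
CVertex n k = Fin n × Fin k

cset : ∀ {n k} → Fin n → Fin k → CVertex n k
cset i a = (i , a)

-- G is an even carousel of order s on n sets (with k = 2^s - 1).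
-- κ i is the kind of the triple (G, X_{i+1}, X_{i+2}) (indices mod n).
EvenCarousel : (n s : ℕ) → SimpleGraph (CVertex n (2 ^ s ∸ 1)) → Set
EvenCarousel n s G =
  ∃ λ (κ : Fin n → Kind) →
    (∀ (i : Fin n) → toℕ i ≡ 0 → κ i ≡ crossing) ×
    (∀ (i : Fin n) (p : suc (toℕ i) < n) →
       TriplePattern (adj G) (cset i) (cset (fromℕ< p)) (regularPattern k (κ i))) ×
    (∀ (i z : Fin n) → suc (toℕ i) ≡ n → toℕ z ≡ 0 →
       TriplePattern (adj G) (cset i) (cset z) (expandingPattern k (κ i))) ×
    (countTrue (isCross ∘ κ) % 2 ≡ 0)
  where k = 2 ^ s ∸ 1

-- X_{1,t} ⊆ W, where W is given by its characteristic function: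
-- x_1^j ∈ W for all 2^(t-1) ≤ j ≤ 2^t - 1.
X1tSubset : ∀ {n k} → ℕ → (CVertex n k → Bool) → Set
X1tSubset {n} {k} t W =
  ∀ (i : Fin n) (a : Fin k) → toℕ i ≡ 0 →
    2 ^ (t ∸ 1) ≤ suc (toℕ a) → suc (toℕ a) ≤ 2 ^ t ∸ 1 → W (i , a) ≡ true

-- For each of 2r consecutive
-- blocks X_{1,t} that meets both Y and Z, the vertex of X₂ whose neighbourhood in X₁
-- is exactly {x₁ʲ : j ≥ 2^(t-1)} acts as a threshold. Half of these 2r thresholds
-- lie on a common side; against a vertex of each of their blocks taken from the
-- other side they form a unitriangular Y×Z submatrix of size r, so rk(Y,Z) ≥ r.
module Submission where

open import Defs hiding (sym)
open import Data.Nat using (ℕ; zero; suc; _+_; _*_; _∸_; _^_; _≤_; _<_; _≤ᵇ_; _≤?_; _<?_; z≤n; s≤s)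
open import Data.Nat.Properties
  using (≤-refl; ≤-trans; <-≤-trans; ≤-<-trans; <⇒≤; <⇒≱; +-comm; +-suc; m+[n∸m]≡n;
         +-monoˡ-≤; +-monoʳ-≤; +-monoʳ-<; +-cancelʳ-≤; m≤m+n; ∸-monoʳ-<;
         m^n>0; m^n≢0; ^-monoʳ-≤; m≤pred[n]⇒suc[m]≤n; ≤ᵇ⇒≤; ≤⇒≤ᵇ; ≤ᵇ-reflects-≤)
open import Data.Fin using (Fin; zero; suc; toℕ; fromℕ<)
import Data.Fin as Fin
open import Data.Fin.Properties using (toℕ<n; toℕ-fromℕ<; toℕ-injective; any?; <-cmp; ≤∧≢⇒<)
  renaming (suc-injective to Fin-suc-injective; ≤-refl to Fin-≤-refl)
open import Data.Bool using (Bool; true; false; not; _∧_)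
import Data.Bool as Bool
open import Data.Bool.Properties using (∧-zeroʳ; ¬-not; not-injective)
open import Data.Product using (∃; _×_; _,_; proj₁)
open import Data.Sum using (_⊎_; inj₁; inj₂)
import Data.Sum as Sum
open import Data.Empty using (⊥-elim)
open import Function using (_∘_)
open import Relation.Binary.Definitions using (tri<; tri≈; tri>)
open import Relation.Binary.PropositionalEquality
  using (_≡_; _≢_; refl; sym; trans; cong; cong₂; subst; module ≡-Reasoning)
open import Relation.Nullary using (yes; no; contradiction)
open import Relation.Nullary.Decidable using (_×-dec_; dec-true; dec-false)
open import Relation.Nullary.Reflects using (det; fromEquivalence)
open import Relation.Unary using (Decidable)

∃-or-∀ : ∀ {m} {P Q : Fin m → Set} → (∀ i → P i ⊎ Q i) → ∃ P ⊎ (∀ i → Q i)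
∃-or-∀ {zero}  _ = inj₂ λ ()
∃-or-∀ {suc m} p⊎q with p⊎q zero | ∃-or-∀ (p⊎q ∘ suc)
... | inj₁ p | _            = inj₁ (zero , p)
... | inj₂ _ | inj₁ (i , p) = inj₁ (suc i , p)
... | inj₂ q | inj₂ qs      = inj₂ λ { zero → q ; (suc i) → qs i }

uncovered-or-covered : ∀ {m} {B : Fin m → Set} → Decidable B → (W : Fin m → Bool) →
                       (∃ λ a → B a × W a ≡ false) ⊎ (∀ a → B a → W a ≡ true)
uncovered-or-covered {B = B} B? W = ∃-or-∀ classify
  where
  classify : ∀ a → (B a × W a ≡ false) ⊎ (B a → W a ≡ true)
  classify a with B? a | W a
  ... | no ¬b | _     = inj₂ λ b → contradiction b ¬b
  ... | yes b | false = inj₁ (b , refl)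
  ... | yes _ | true  = inj₂ λ _ → refl

least : ∀ {m} (S : Fin m → Bool) → ∃ (λ i → S i ≡ true) →
        ∃ λ l → S l ≡ true × (∀ i → i Fin.< l → S i ≡ false)
least {suc m} S _ with S zero in S₀
least S _            | true  = zero , S₀ , λ _ ()
least S (zero , S0)  | false = contradiction (trans (sym S0) S₀) λ ()
least S (suc i , Si) | false with least (S ∘ suc) (i , Si)
... | l , Sl , below = suc l , Sl , λ { zero _ → S₀ ; (suc j) (s≤s j<l) → below j j<l }

greatest : ∀ {m} (S : Fin m → Bool) → ∃ (λ i → S i ≡ true) →
           ∃ λ l → S l ≡ true × (∀ i → l Fin.< i → S i ≡ false)
greatest {suc m} S _ with any? (λ j → S (suc j) Bool.≟ true)
greatest S _            | yes later with greatest (S ∘ suc) later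
... | l , Sl , above = suc l , Sl , λ { zero () ; (suc j) (s≤s l<j) → above j l<j }
greatest S (zero , S0)  | no none = zero , S0 , λ { zero () ; (suc j) _ → ¬-not (none ∘ (j ,_)) }
greatest S (suc i , Si) | no none = contradiction (i , Si) none

∧-false : ∀ {a b} → a ≡ false ⊎ b ≡ false → a ∧ b ≡ false
∧-false     (inj₁ refl) = refl
∧-false {a} (inj₂ refl) = ∧-zeroʳ a

xorSum-allFalse : ∀ {m} (h : Fin m → Bool) → (∀ i → h i ≡ false) → xorSum h ≡ false
xorSum-allFalse {zero}  _ _ = refl
xorSum-allFalse {suc m} h h≡false rewrite h≡false zero =
  xorSum-allFalse (h ∘ suc) (h≡false ∘ suc)

xorSum-singleton : ∀ {m} (h : Fin m → Bool) l → h l ≡ true → (∀ i → i ≢ l → h i ≡ false) →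
                   xorSum h ≡ true
xorSum-singleton h zero hl rest
  rewrite hl | xorSum-allFalse (h ∘ suc) (λ i → rest (suc i) λ ()) = refl
xorSum-singleton h (suc l) hl rest rewrite rest zero λ () =
  xorSum-singleton (h ∘ suc) l hl λ i i≢l → rest (suc i) (i≢l ∘ Fin-suc-injective)

module _ {V : Set} (adjm : V → V → Bool) (Y Z : V → Bool) {r : ℕ} (row col : Fin r → V)
         (row∈Y : ∀ i → Y (row i) ≡ true) (col∈Z : ∀ l → Z (col l) ≡ true) where

  private
    Pivot : (Fin r → Bool) → Fin r → Set
    Pivot S l = S l ≡ true × adjm (row l) (col l) ≡ true ×
                (∀ i → i ≢ l → S i ≡ false ⊎ adjm (row i) (col l) ≡ false)

    rankAtLeast-byPivots : (∀ S → ∃ (λ i → S i ≡ true) → ∃ (Pivot S)) → RankAtLeast adjm Y Z r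
    rankAtLeast-byPivots pivot = row , row∈Y , λ S S≢0 →
      let (l , Sl , diag , off) = pivot S S≢0 in
      col l , col∈Z l , xorSum-singleton _ l (cong₂ _∧_ Sl diag) λ i i≢l → ∧-false (off i i≢l)

  lowerUnitriangular⇒rankAtLeast :
    (∀ {i l} → l Fin.≤ i → adjm (row i) (col l) ≡ true) →
    (∀ {i l} → i Fin.< l → adjm (row i) (col l) ≡ false) →
    RankAtLeast adjm Y Z r
  lowerUnitriangular⇒rankAtLeast on-or-below above = rankAtLeast-byPivots λ S S≢0 →
    let (l , Sl , after) = greatest S S≢0 in
    l , Sl , on-or-below Fin-≤-refl , λ i i≢l → case-split S l after i i≢l
    where
    case-split : ∀ S l → (∀ i → l Fin.< i → S i ≡ false) →
                 ∀ i → i ≢ l → S i ≡ false ⊎ adjm (row i) (col l) ≡ false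
    case-split S l after i i≢l with <-cmp i l
    ... | tri< i<l _ _ = inj₂ (above i<l)
    ... | tri≈ _ i≡l _ = contradiction i≡l i≢l
    ... | tri> _ _ l<i = inj₁ (after i l<i)

  upperUnitriangular⇒rankAtLeast :
    (∀ {i l} → i Fin.≤ l → adjm (row i) (col l) ≡ true) →
    (∀ {i l} → l Fin.< i → adjm (row i) (col l) ≡ false) →
    RankAtLeast adjm Y Z r
  upperUnitriangular⇒rankAtLeast on-or-above below = rankAtLeast-byPivots λ S S≢0 →
    let (l , Sl , before) = least S S≢0 in
    l , Sl , on-or-above Fin-≤-refl , λ i i≢l → case-split S l before i i≢l
    where
    case-split : ∀ S l → (∀ i → i Fin.< l → S i ≡ false) →
                 ∀ i → i ≢ l → S i ≡ false ⊎ adjm (row i) (col l) ≡ false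
    case-split S l before i i≢l with <-cmp i l
    ... | tri< i<l _ _ = inj₁ (before i i<l)
    ... | tri≈ _ i≡l _ = contradiction i≡l i≢l
    ... | tri> _ _ l<i = inj₂ (below l<i)

record Subsequence {N : ℕ} (P : Fin N → Set) (m : ℕ) : Set where
  field
    index      : Fin m → Fin N
    increasing : ∀ {i j} → i Fin.< j → index i Fin.< index j
    satisfies  : ∀ i → P (index i)

  monotone : ∀ {i j} → i Fin.≤ j → index i Fin.≤ index j
  monotone {i} {j} i≤j with i Fin.≟ j
  ... | yes refl = Fin-≤-refl
  ... | no i≢j   = <⇒≤ (increasing (≤∧≢⇒< i≤j i≢j))
open Subsequence

[] : ∀ {N} {P : Fin N → Set} → Subsequence P 0
[] .index ()
[] .increasing {()}
[] .satisfies ()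

_∷_ : ∀ {N m} {P : Fin (suc N) → Set} → P zero → Subsequence (P ∘ suc) m → Subsequence P (suc m)
(p ∷ s) .index zero    = zero
(p ∷ s) .index (suc i) = suc (s .index i)
(p ∷ s) .increasing {zero}  {suc _} _         = s≤s z≤n
(p ∷ s) .increasing {suc _} {suc _} (s≤s i<j) = s≤s (s .increasing i<j)
(p ∷ s) .satisfies zero    = p
(p ∷ s) .satisfies (suc i) = s .satisfies i

shift : ∀ {N m} {P : Fin (suc N) → Set} → Subsequence (P ∘ suc) m → Subsequence P m
shift s .index      = suc ∘ s .index
shift s .increasing = s≤s ∘ s .increasing
shift s .satisfies  = s .satisfies

monochromatic-subsequence : ∀ {N} a b (c : Fin N → Bool) → a + b ≤ N →
  Subsequence (λ i → c i ≡ true) a ⊎ Subsequence (λ i → c i ≡ false) b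
monochromatic-subsequence zero    _       _ _ = inj₁ []
monochromatic-subsequence (suc a) zero    _ _ = inj₂ []
monochromatic-subsequence {suc N} (suc a) (suc b) c (s≤s a+1+b≤N) with c zero in c₀
... | true  = Sum.map (c₀ ∷_) shift (monochromatic-subsequence a (suc b) (c ∘ suc) a+1+b≤N)
... | false = Sum.map shift (c₀ ∷_)
                (monochromatic-subsequence (suc a) b (c ∘ suc) (subst (_≤ N) (+-suc a b) a+1+b≤N))

crossing-threshold : ∀ {k p} j → p ≤ k → ((k + 1) ≤ᵇ (j + suc (k ∸ p))) ≡ (p ≤ᵇ j)
crossing-threshold {k} {p} j p≤k =
  det (fromEquivalence (cancel ∘ ≤ᵇ⇒≤ _ _) (≤⇒≤ᵇ ∘ shift-by-k∸p)) (≤ᵇ-reflects-≤ p j)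
  where
  k+1≡p+[k∸p]+1 : k + 1 ≡ p + suc (k ∸ p)
  k+1≡p+[k∸p]+1 =
    trans (+-comm k 1) (trans (cong suc (sym (m+[n∸m]≡n p≤k))) (sym (+-suc p (k ∸ p))))

  cancel : k + 1 ≤ j + suc (k ∸ p) → p ≤ j
  cancel = +-cancelʳ-≤ (suc (k ∸ p)) p j ∘ subst (_≤ j + suc (k ∸ p)) k+1≡p+[k∸p]+1

  shift-by-k∸p : p ≤ j → k + 1 ≤ j + suc (k ∸ p)
  shift-by-k∸p = subst (_≤ j + suc (k ∸ p)) (sym k+1≡p+[k∸p]+1) ∘ +-monoˡ-≤ (suc (k ∸ p))

module CrossingBlocks
  {V : Set} (G : SimpleGraph V) {k : ℕ} (u v : Fin k → V)
  (cross : TriplePattern (adj G) u v (regularPattern k crossing))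
  (inY : V → Bool)
  {m : ℕ} (lo hi : Fin m → ℕ)
  (lo>0 : ∀ β → 0 < lo β) (hi≤lo : ∀ {β β′} → β Fin.< β′ → hi β ≤ lo β′)
  where

  InBlock : Fin m → Fin k → Set
  InBlock β a = lo β ≤ suc (toℕ a) × suc (toℕ a) < hi β

  InBlock? : ∀ β → Decidable (InBlock β)
  InBlock? β a = lo β ≤? suc (toℕ a) ×-dec suc (toℕ a) <? hi β

  Monochromatic : Fin m → (V → Bool) → Set
  Monochromatic β W = ∀ a → InBlock β a → W (u a) ≡ true

  record Bichromatic (β : Fin m) : Set where
    field
      y z : Fin k
      y∈β : InBlock β y
      z∈β : InBlock β z
      y∈Y : inY (u y) ≡ true
      z∈Z : inY (u z) ≡ false
  open Bichromatic

  monochromatic-or-bichromatic :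
    ∀ β → (Monochromatic β (λ x → not (inY x)) ⊎ Monochromatic β inY) ⊎ Bichromatic β
  monochromatic-or-bichromatic β
    with uncovered-or-covered (InBlock? β) (λ a → not (inY (u a)))
       | uncovered-or-covered (InBlock? β) (λ a → inY (u a))
  ... | inj₂ ⊆Z | _      = inj₁ (inj₁ ⊆Z)
  ... | inj₁ _  | inj₂ ⊆Y = inj₁ (inj₂ ⊆Y)
  ... | inj₁ (y , y∈β , y∉Z) | inj₁ (z , z∈β , z∉Y) =
    inj₂ record { y = y ; z = z ; y∈β = y∈β ; z∈β = z∈β ; y∈Y = not-injective y∉Z ; z∈Z = z∉Y }

  module _ (bichromatic : ∀ β → Bichromatic β) where

    private
      lo≤k : ∀ β → lo β ≤ k
      lo≤k β = ≤-trans (proj₁ (y∈β (bichromatic β))) (toℕ<n (y (bichromatic β)))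

      lo<hi : ∀ β → lo β < hi β
      lo<hi β = let (lo≤y , y<hi) = y∈β (bichromatic β) in ≤-<-trans lo≤y y<hi

    threshold : Fin m → Fin k
    threshold β = fromℕ< (∸-monoʳ-< {k} {lo β} {0} (lo>0 β) (lo≤k β))

    adj-threshold : ∀ β a → adj G (u a) (v (threshold β)) ≡ (lo β ≤ᵇ suc (toℕ a))
    adj-threshold β a = begin
      adj G (u a) (v (threshold β))
        ≡⟨ cross a (threshold β) ⟩
      (k + 1 ≤ᵇ suc (toℕ a) + suc (toℕ (threshold β)))
        ≡⟨ cong (λ i → k + 1 ≤ᵇ suc (toℕ a) + suc i) (toℕ-fromℕ< _) ⟩
      (k + 1 ≤ᵇ suc (toℕ a) + suc (k ∸ lo β))
        ≡⟨ crossing-threshold (suc (toℕ a)) (lo≤k β) ⟩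
      (lo β ≤ᵇ suc (toℕ a))
        ∎
      where open ≡-Reasoning

    lo-≤-member : ∀ {β β′ a} → InBlock β a → β′ Fin.≤ β → lo β′ ≤ suc (toℕ a)
    lo-≤-member {β} {β′} (lo≤a , _) β′≤β with β′ Fin.≟ β
    ... | yes refl = lo≤a
    ... | no β′≢β  = ≤-trans (<⇒≤ (lo<hi β′)) (≤-trans (hi≤lo (≤∧≢⇒< β′≤β β′≢β)) lo≤a)

    member-<-lo : ∀ {β β′ a} → InBlock β a → β Fin.< β′ → suc (toℕ a) < lo β′
    member-<-lo (_ , a<hi) β<β′ = <-≤-trans a<hi (hi≤lo β<β′)

    adj-threshold-≤ : ∀ {β β′ a} → InBlock β a → β′ Fin.≤ β → adj G (u a) (v (threshold β′)) ≡ true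
    adj-threshold-≤ {β′ = β′} {a} a∈β β′≤β =
      trans (adj-threshold β′ a) (dec-true (lo β′ ≤? suc (toℕ a)) (lo-≤-member a∈β β′≤β))

    adj-threshold-> : ∀ {β β′ a} → InBlock β a → β Fin.< β′ → adj G (u a) (v (threshold β′)) ≡ false
    adj-threshold-> {β′ = β′} {a} a∈β β<β′ =
      trans (adj-threshold β′ a) (dec-false (lo β′ ≤? suc (toℕ a)) (<⇒≱ (member-<-lo a∈β β<β′)))

    rankAtLeast : ∀ {r} → r + r ≤ m → RankAtLeast (adj G) inY (λ x → not (inY x)) r
    rankAtLeast {r} r+r≤m with monochromatic-subsequence r r (λ β → inY (v (threshold β))) r+r≤m
    ... | inj₁ s = upperUnitriangular⇒rankAtLeast (adj G) inY (λ x → not (inY x))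
        (λ i → v (threshold (s .index i))) (λ l → u (z (bichromatic (s .index l))))
        (s .satisfies) (λ l → cong not (z∈Z (bichromatic (s .index l))))
        (λ {_} {l} i≤l → trans (SimpleGraph.sym G _ _)
          (adj-threshold-≤ (z∈β (bichromatic (s .index l))) (monotone s i≤l)))
        (λ {_} {l} l<i → trans (SimpleGraph.sym G _ _)
          (adj-threshold-> (z∈β (bichromatic (s .index l))) (s .increasing l<i)))
    ... | inj₂ s = lowerUnitriangular⇒rankAtLeast (adj G) inY (λ x → not (inY x))
        (λ i → u (y (bichromatic (s .index i)))) (λ l → v (threshold (s .index l)))
        (λ i → y∈Y (bichromatic (s .index i))) (λ l → cong not (s .satisfies l))
        (λ {i} l≤i → adj-threshold-≤ (y∈β (bichromatic (s .index i))) (monotone s l≤i))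
        (λ {i} i<l → adj-threshold-> (y∈β (bichromatic (s .index i))) (s .increasing i<l))

module X₁Blocks
  {n k : ℕ} (G : SimpleGraph (CVertex (suc n) k)) (second : Fin (suc n))
  (cross : TriplePattern (adj G) (cset zero) (cset second) (regularPattern k crossing))
  (inY : CVertex (suc n) k → Bool) (q m : ℕ)
  where

  open CrossingBlocks G (cset zero) (cset second) cross inY {m}
    (λ β → 2 ^ (q + toℕ β)) (λ β → 2 ^ (suc q + toℕ β))
    (λ β → m^n>0 2 (q + toℕ β)) (λ β<β′ → ^-monoʳ-≤ 2 (+-monoʳ-< q β<β′))

  monochromatic⇒X1tSubset : ∀ {β W} → Monochromatic β W → X1tSubset (suc q + toℕ β) W
  monochromatic⇒X1tSubset {β} {W} mono i a i≡0 lo≤a a≤hi∸1 =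
    subst (λ i → W (i , a) ≡ true) (sym (toℕ-injective {j = zero} i≡0))
      (mono a (lo≤a , m≤pred[n]⇒suc[m]≤n {{m^n≢0 2 (suc q + toℕ β)}} a≤hi∸1))

  some-block-monochromatic : ∀ {r} → r + r ≤ m → RankLessThan (adj G) inY (λ x → not (inY x)) r →
    ∃ λ β → X1tSubset (suc q + toℕ β) (λ x → not (inY x)) ⊎ X1tSubset (suc q + toℕ β) inY
  some-block-monochromatic r+r≤m rank<r with ∃-or-∀ monochromatic-or-bichromatic
  ... | inj₁ (β , mono) = β , Sum.map monochromatic⇒X1tSubset monochromatic⇒X1tSubset mono
  ... | inj₂ bichromatic = ⊥-elim (rank<r (rankAtLeast bichromatic r+r≤m))

lemma10 : (n r q : ℕ) → 3 ≤ n → 2 ≤ r → 1 ≤ q →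
          10 * (n + 1) * (q + 8 * r + 1) * r ≤ 2 ^ (q + 8 * r ∸ 1) →
          (G : SimpleGraph (CVertex n (2 ^ (q + 8 * r + 1) ∸ 1))) →
          EvenCarousel n (q + 8 * r + 1) G →
          (inY : CVertex n (2 ^ (q + 8 * r + 1) ∸ 1) → Bool) →
          RankLessThan (adj G) inY (λ v → not (inY v)) r →
          ∃ λ t → q ≤ t × t ≤ q + 8 * r ∸ 1 ×
            (X1tSubset t (λ v → not (inY v)) ⊎ X1tSubset t inY)
lemma10 (suc (suc n)) r (suc q) _ _ _ _ G (_ , first-is-crossing , regular , _) inY rank<r =
  let (β , monochromatic) = some-block-monochromatic ≤-refl rank<r in
  suc q + toℕ β , m≤m+n (suc q) (toℕ β) , block-bound β , monochromatic
  where
  k : ℕ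
  k = 2 ^ (suc q + 8 * r + 1) ∸ 1

  X₁X₂-crossing : TriplePattern (adj G) (cset zero) (cset (fromℕ< (s≤s (s≤s z≤n))))
                    (regularPattern k crossing)
  X₁X₂-crossing = subst (λ κ → TriplePattern (adj G) _ _ (regularPattern k κ))
                    (first-is-crossing zero refl) (regular zero (s≤s (s≤s z≤n)))

  open X₁Blocks G _ X₁X₂-crossing inY q (r + r)

  block-bound : (β : Fin (r + r)) → suc q + toℕ β ≤ q + 8 * r
  block-bound β = +-monoʳ-< q (<-≤-trans (toℕ<n β) (+-monoʳ-≤ r (m≤m+n r (6 * r))))
lemma10 0             _ _ ()               _ _ _ _ _ _ _
lemma10 1             _ _ (s≤s ())         _ _ _ _ _ _ _
lemma10 (suc (suc _)) _ 0 _ _ () _ _ _ _ _
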